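{- Every cocomparability graph $G$ is $1$-hyperbolic, and $\delta^*(G)=1$ if and only if $G$ contains the $4$-cycle $C_4$ as an isometric subgraph.
   Context: Graphs are simple, unweighted, connected, possibly infinite, with shortest-path metric $d_G$, $xy:=d_G(x,y)$. For vertices $x,y,u,v$, $\delta(x,y,u,v)$ is the difference between the largest and second largest of $\frac{uv+xy}{2},\frac{ux+vy}{2},\frac{uy+vx}{2}$; $G$ is $\delta$-hyperbolic if $\delta(x,y,u,v)\le\delta$ for all vertices; $\delta^*(G)$ is the minimum half-integer $\delta$ for which $G$ is $\delta$-hyperbolic. A cocomparability graph is a graph whose complement is a comparability graph (admits a transitive orientation). A subgraph $H$ is isometric if $d_H=d_G$ on $V(H)$. -}

module Defs where

open import Data.Nat using (ℕ; zero; suc; _+_; _∸_; _≤_; _⊔_; _⊓_)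
import Data.Fin
import Data.Nat
open import Data.Fin using (Fin)
open import Data.Product using (Σ; _×_; ∃; _,_)
open import Data.Sum using (_⊎_)
open import Relation.Nullary using (¬_)
open import Relation.Binary.PropositionalEquality using (_≡_; _≢_)
open import Function.Definitions using (Injective)

record Graph : Set₁ where
  field
    V     : Set
    Adj   : V → V → Set
    irrefl : ∀ {x} → ¬ Adj x x
    sym    : ∀ {x y} → Adj x y → Adj y x
open Graph public

data Walk (G : Graph) : V G → V G → ℕ → Set where
  here : ∀ {x} → Walk G x x zero
  step : ∀ {x y z n} → Adj G x y → Walk G y z n → Walk G x z (suc n)

Connected : Graph → Set
Connected G = ∀ (x y : V G) → ∃ λ n → Walk G x y n

Dist : (G : Graph) → V G → V G → ℕ → Set
Dist G x y n = Walk G x y n × (∀ m → Walk G x y m → n ≤ m)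

max3 : ℕ → ℕ → ℕ → ℕ
max3 a b c = a ⊔ b ⊔ c

mid3 : ℕ → ℕ → ℕ → ℕ
mid3 a b c = (a ⊓ b) ⊔ (b ⊓ c) ⊔ (a ⊓ c)

-- Twice δ(x,y,u,v), computed from the three doubled sums
-- uv+xy, ux+vy, uy+vx: (largest − second largest).
twiceδ : ℕ → ℕ → ℕ → ℕ
twiceδ s₁ s₂ s₃ = max3 s₁ s₂ s₃ ∸ mid3 s₁ s₂ s₃

-- G is δ-hyperbolic for the half-integer δ = k/2.
HalfHyperbolic : Graph → ℕ → Set
HalfHyperbolic G k =
  ∀ (x y u v : V G) (xy uv ux vy uy vx : ℕ) →
    Dist G x y xy → Dist G u v uv → Dist G u x ux →
    Dist G v y vy → Dist G u y uy → Dist G v x vx →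
    twiceδ (uv + xy) (ux + vy) (uy + vx) ≤ k

-- δ*(G) = k/2 : k/2 is the minimum half-integer δ with G δ-hyperbolic.
HyperbolicityIs : Graph → ℕ → Set
HyperbolicityIs G k = HalfHyperbolic G k × (∀ j → HalfHyperbolic G j → k ≤ j)

ComplementEdge : (G : Graph) → V G → V G → Set
ComplementEdge G x y = x ≢ y × ¬ Adj G x y

record TransitiveOrientationOfComplement (G : Graph) : Set₁ where
  field
    Arc      : V G → V G → Set
    arc-edge : ∀ {x y} → Arc x y → ComplementEdge G x y
    orient   : ∀ {x y} → ComplementEdge G x y → Arc x y ⊎ Arc y x
    antisym  : ∀ {x y} → Arc x y → ¬ Arc y x
    trans    : ∀ {x y z} → Arc x y → Arc y z → Arc x z

Cocomparability : Graph → Set₁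
Cocomparability G = TransitiveOrientationOfComplement G

data C4Adj : Fin 4 → Fin 4 → Set where
  e01 : C4Adj (Fin.zero) (Fin.suc Fin.zero)
  e12 : C4Adj (Fin.suc Fin.zero) (Fin.suc (Fin.suc Fin.zero))
  e23 : C4Adj (Fin.suc (Fin.suc Fin.zero)) (Fin.suc (Fin.suc (Fin.suc Fin.zero)))
  e30 : C4Adj (Fin.suc (Fin.suc (Fin.suc Fin.zero))) (Fin.zero)

dC4 : Fin 4 → Fin 4 → ℕ
dC4 i j with Data.Fin.toℕ i | Data.Fin.toℕ j
... | a | b = dd ((a + 4 ∸ b) Data.Nat.% 4)
  where
    dd : ℕ → ℕ
    dd 0 = 0
    dd 1 = 1
    dd 2 = 2
    dd _ = 1

record IsometricC4 (G : Graph) : Set where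
  field
    f        : Fin 4 → V G
    inj      : Injective _≡_ _≡_ f
    edges    : ∀ {i j} → C4Adj i j → Adj G (f i) (f j)
    isometric : ∀ i j → Dist G (f i) (f j) (dC4 i j)

module Submission where

-- Fix a transitive orientation → of the complement of G.  If a → b → c, a walk from a to c stays
-- below b (by transitivity) until it meets the closed neighbourhood of b, so every a–c path meets
-- N[b]; hence d(a,b) + d(b,c) ≤ d(a,c) + 2 and d(a,b), d(b,c) ≤ d(a,c).  If twice δ(x,y,u,v) ≥ k,
-- relabel the four points as a quadrangle a b c d whose diagonal sum d(a,c) + d(b,d) beats both
-- sums of opposite sides by k.  For k = 3 all six pairs are at distance ≥ 2, so the orientation
-- orders the four points as a chain, and the inequalities above rule out such a dominance.
-- For k = 2 they are tight, which yields vertices adjacent to a middle vertex on geodesics; every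
-- case ends in a "tripod" (a path a b c with d(a,c) = 2 and a vertex e with d(a,e) = d(c,e) =
-- d(b,e) - 1) or a "ladder" (two edges joined by two equally long geodesics, diagonals one longer),
-- and these shrink, the orientation forcing each new rung to be an edge, to an isometric 4-cycle.
-- Distances are least walk lengths, which exist by excluded middle.

open import Defs
open import Level using (0ℓ)
open import Axiom.ExcludedMiddle using (ExcludedMiddle)
open import Data.Nat using (ℕ; zero; suc; _+_; _≤_; _<_; _⊓_; z≤n; s≤s; _≤?_)
open import Data.Nat.Properties
open import Algebra.Properties.CommutativeSemigroup +-commutativeSemigroup
  using (interchange; x∙yz≈y∙xz; x∙yz≈yx∙z; xy∙z≈x∙zy; xy∙z≈xz∙y)
open import Data.Nat.Tactic.RingSolver using (solve-∀)
open import Data.Product using (Σ; ∃; _×_; _,_; proj₁; proj₂)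
open import Data.Fin using (Fin; zero; suc)
open import Data.Sum using (_⊎_; inj₁; inj₂; swap)
open import Data.Empty using (⊥-elim)
open import Function.Bundles using (_⇔_; mk⇔)
open import Relation.Nullary using (¬_; Dec; yes; no)
open import Relation.Nullary.Decidable using (decidable-stable)
open import Relation.Binary.PropositionalEquality as ≡
  using (_≡_; _≢_; refl; cong; subst; subst₂)

≰2⇒≤1 : ∀ {n} → ¬ 2 ≤ n → n ≤ 1
≰2⇒≤1 2≰n = ≤-pred (≰⇒> 2≰n)

≡1+⇒1≤ : ∀ {m n} → m ≡ 1 + n → 1 ≤ m
≡1+⇒1≤ refl = s≤s z≤n

≡2+⇒2≤ : ∀ {m n} → m ≡ 2 + n → 2 ≤ m
≡2+⇒2≤ refl = s≤s (s≤s z≤n)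

m+3≰m+2 : ∀ m → ¬ m + 3 ≤ m + 2
m+3≰m+2 m h with +-cancelˡ-≤ m 3 2 h
... | s≤s (s≤s ())

≤-sum-tight : ∀ {a b i j} → a ≤ i → b ≤ j → i + j ≤ a + b → a ≡ i × b ≡ j
≤-sum-tight {a} {b} {i} {j} a≤i b≤j ij≤ab =
  ≤-antisym a≤i (+-cancelʳ-≤ j i a (≤-trans ij≤ab (+-monoʳ-≤ a b≤j))) ,
  ≤-antisym b≤j (+-cancelˡ-≤ i j b (≤-trans ij≤ab (+-monoˡ-≤ b a≤i)))

⊓≤mid3₁₂ : ∀ a b c → a ⊓ b ≤ mid3 a b c
⊓≤mid3₁₂ a b c = ≤-trans (m≤m⊔n (a ⊓ b) (b ⊓ c)) (m≤m⊔n _ (a ⊓ c))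

⊓≤mid3₂₃ : ∀ a b c → b ⊓ c ≤ mid3 a b c
⊓≤mid3₂₃ a b c = ≤-trans (m≤n⊔m (a ⊓ b) (b ⊓ c)) (m≤m⊔n _ (a ⊓ c))

⊓≤mid3₁₃ : ∀ a b c → a ⊓ c ≤ mid3 a b c
⊓≤mid3₁₃ a b c = m≤n⊔m _ (a ⊓ c)

≤-⊓-+ : ∀ k {x y} → ¬ y + suc k ≤ x → x ≤ x ⊓ y + k
≤-⊓-+ k {x} {y} y+k≮x = subst (x ≤_) (≡.sym (+-distribʳ-⊓ k x y)) (⊓-glb (m≤m+n x k) x≤y+k)
  where
  x≤y+k : x ≤ y + k
  x≤y+k = ≤-pred (subst (suc x ≤_) (+-suc y k) (≰⇒> y+k≮x))

below-or-dominant : ∀ k {x y z m} → x ⊓ y ≤ m → x ⊓ z ≤ m →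
  x ≤ m + k ⊎ (y + suc k ≤ x × z + suc k ≤ x)
below-or-dominant k xy≤m xz≤m with _ + suc k ≤? _ | _ + suc k ≤? _
... | yes y≪x | yes z≪x = inj₂ (y≪x , z≪x)
... | no y≪̸x  | _        = inj₁ (≤-trans (≤-⊓-+ k y≪̸x) (+-monoˡ-≤ k xy≤m))
... | yes _   | no z≪̸x  = inj₁ (≤-trans (≤-⊓-+ k z≪̸x) (+-monoˡ-≤ k xz≤m))

data Dominant (k a b c : ℕ) : Set where
  first  : b + k ≤ a → c + k ≤ a → Dominant k a b c
  second : a + k ≤ b → c + k ≤ b → Dominant k a b c
  third  : a + k ≤ c → b + k ≤ c → Dominant k a b c

twiceδ-dominant : ∀ k a b c → suc k ≤ twiceδ a b c → Dominant (suc k) a b c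
twiceδ-dominant k a b c k<δ
  with below-or-dominant k (⊓≤mid3₁₂ a b c) (⊓≤mid3₁₃ a b c)
     | below-or-dominant k (≤-trans (≤-reflexive (⊓-comm b a)) (⊓≤mid3₁₂ a b c)) (⊓≤mid3₂₃ a b c)
     | below-or-dominant k (≤-trans (≤-reflexive (⊓-comm c a)) (⊓≤mid3₁₃ a b c))
                           (≤-trans (≤-reflexive (⊓-comm c b)) (⊓≤mid3₂₃ a b c))
... | inj₂ (b≪a , c≪a) | _                | _                = first b≪a c≪a
... | inj₁ _           | inj₂ (a≪b , c≪b) | _                = second a≪b c≪b
... | inj₁ _           | inj₁ _           | inj₂ (a≪c , b≪c) = third a≪c b≪c
... | inj₁ a≤          | inj₁ b≤          | inj₁ c≤          =
  ⊥-elim (<⇒≱ k<δ (m≤n+o⇒m∸n≤o (max3 a b c) (mid3 a b c) (⊔-lub (⊔-lub a≤ b≤) c≤)))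

module _ (em : ExcludedMiddle 0ℓ) {P : ℕ → Set} where

  least : ∀ n → P n → Σ ℕ λ m → P m × (∀ k → P k → m ≤ k)
  least n pn = below (suc n) n ≤-refl pn
    where
    below : ∀ b n → n < b → P n → Σ ℕ λ m → P m × (∀ k → P k → m ≤ k)
    below (suc b) n (s≤s n≤b) pn with anyUpTo? (λ _ → em) n
    ... | yes (m , m<n , pm) = below b m (≤-trans m<n n≤b) pm
    ... | no none            = n , pn , λ k pk → ≮⇒≥ λ k<n → none (k , k<n , pk)

-- Walks and the shortest-path metric

module Walks {G : Graph} where

  _++_ : ∀ {x y z m n} → Walk G x y m → Walk G y z n → Walk G x z (m + n)
  here     ++ w′ = w′
  step e w ++ w′ = step e (w ++ w′)

  _∷ʳ_ : ∀ {x y z n} → Walk G x y n → Adj G y z → Walk G x z (suc n)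
  here     ∷ʳ e = step e here
  step f w ∷ʳ e = step f (w ∷ʳ e)

  reverse : ∀ {x y n} → Walk G x y n → Walk G y x n
  reverse here       = here
  reverse (step e w) = reverse w ∷ʳ Graph.sym G e

  splitAt : ∀ i {j x z} → Walk G x z (i + j) → Σ (V G) λ w → Walk G x w i × Walk G w z j
  splitAt zero    w          = _ , here , w
  splitAt (suc i) (step e w) with splitAt i w
  ... | v , w₁ , w₂ = v , step e w₁ , w₂

  empty⇒≡ : ∀ {x y} → Walk G x y 0 → x ≡ y
  empty⇒≡ here = refl

dC4≡0⇒≡ : ∀ i j → dC4 i j ≡ 0 → i ≡ j
dC4≡0⇒≡ zero                   zero                   _  = refl
dC4≡0⇒≡ zero                   (suc zero)             ()
dC4≡0⇒≡ zero                   (suc (suc zero))       ()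
dC4≡0⇒≡ zero                   (suc (suc (suc zero))) ()
dC4≡0⇒≡ (suc zero)             zero                   ()
dC4≡0⇒≡ (suc zero)             (suc zero)             _  = refl
dC4≡0⇒≡ (suc zero)             (suc (suc zero))       ()
dC4≡0⇒≡ (suc zero)             (suc (suc (suc zero))) ()
dC4≡0⇒≡ (suc (suc zero))       zero                   ()
dC4≡0⇒≡ (suc (suc zero))       (suc zero)             ()
dC4≡0⇒≡ (suc (suc zero))       (suc (suc zero))       _  = refl
dC4≡0⇒≡ (suc (suc zero))       (suc (suc (suc zero))) ()
dC4≡0⇒≡ (suc (suc (suc zero))) zero                   ()
dC4≡0⇒≡ (suc (suc (suc zero))) (suc zero)             ()
dC4≡0⇒≡ (suc (suc (suc zero))) (suc (suc zero))       ()
dC4≡0⇒≡ (suc (suc (suc zero))) (suc (suc (suc zero))) _  = refl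

module Metric (em : ExcludedMiddle 0ℓ) (G : Graph) (connected : Connected G) where
  open Walks {G}

  shortest : ∀ x y → Σ ℕ (Dist G x y)
  shortest x y = least em _ (proj₂ (connected x y))

  -- Opaque, so that distances stay atoms for unification.
  opaque
    dist : V G → V G → ℕ
    dist x y = proj₁ (shortest x y)

    dist-spec : ∀ {x y} → Dist G x y (dist x y)
    dist-spec {x} {y} = proj₂ (shortest x y)

  geodesic : ∀ {x y} → Walk G x y (dist x y)
  geodesic = proj₁ dist-spec

  dist-≤ : ∀ {x y n} → Walk G x y n → dist x y ≤ n
  dist-≤ = proj₂ dist-spec _

  Dist⇒≡ : ∀ {x y n} → Dist G x y n → dist x y ≡ n
  Dist⇒≡ (w , minimal) = ≤-antisym (dist-≤ w) (minimal _ geodesic)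

  ≡⇒Dist : ∀ {x y n} → dist x y ≡ n → Dist G x y n
  ≡⇒Dist refl = dist-spec

  dist-sym : ∀ x y → dist x y ≡ dist y x
  dist-sym x y = ≤-antisym (dist-≤ (reverse geodesic)) (dist-≤ (reverse geodesic))

  dist-triangle : ∀ x y z → dist x z ≤ dist x y + dist y z
  dist-triangle x y z = dist-≤ (geodesic {x} {y} ++ geodesic)

  dist-refl : ∀ {x} → dist x x ≡ 0
  dist-refl = n≤0⇒n≡0 (dist-≤ here)

  dist≡0⇒≡ : ∀ {x y} → dist x y ≡ 0 → x ≡ y
  dist≡0⇒≡ eq = empty⇒≡ (subst (Walk G _ _) eq geodesic)

  adj⇒dist≡1 : ∀ {x y} → Adj G x y → dist x y ≡ 1
  adj⇒dist≡1 e = ≤-antisym (dist-≤ (step e here)) (n≢0⇒n>0 λ eq → Graph.irrefl G (loop eq))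
    where
    loop : dist _ _ ≡ 0 → Adj G _ _
    loop eq = subst (Adj G _) (≡.sym (dist≡0⇒≡ eq)) e

  dist≡1⇒adj : ∀ {x y} → dist x y ≡ 1 → Adj G x y
  dist≡1⇒adj eq with subst (Walk G _ _) eq geodesic
  ... | step e here = e

  adj⇒dist≤1+ : ∀ {x y} z → Adj G x y → dist x z ≤ suc (dist y z)
  adj⇒dist≤1+ z e = dist-≤ (step e geodesic)

  apart-sym : ∀ {x y} → 2 ≤ dist x y → 2 ≤ dist y x
  apart-sym {x} {y} = subst (2 ≤_) (dist-sym x y)

  apart⇒complement : ∀ {x y} → 2 ≤ dist x y → ComplementEdge G x y
  apart⇒complement 2≤xy = (λ { refl → <⇒≱ 2≤xy (≤-trans (≤-reflexive dist-refl) z≤n) }) ,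
                          (λ e → <⇒≱ 2≤xy (≤-reflexive (adj⇒dist≡1 e)))

  complement⇒apart : ∀ {x y} → ComplementEdge G x y → 2 ≤ dist x y
  complement⇒apart {x} {y} (x≢y , ¬xy) with dist x y in eq
  ... | 0           = ⊥-elim (x≢y (dist≡0⇒≡ eq))
  ... | 1           = ⊥-elim (¬xy (dist≡1⇒adj eq))
  ... | suc (suc _) = s≤s (s≤s z≤n)

  apart-left : ∀ {x y z n} → 2 + n ≤ dist x z → dist y z ≤ n → 2 ≤ dist x y
  apart-left {x} {y} {z} {n} 2+n≤xz yz≤n = +-cancelʳ-≤ n 2 (dist x y) (begin
    2 + n               ≤⟨ 2+n≤xz ⟩
    dist x z            ≤⟨ dist-triangle x y z ⟩
    dist x y + dist y z ≤⟨ +-monoʳ-≤ (dist x y) yz≤n ⟩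
    dist x y + n        ∎)
    where open ≤-Reasoning

  apart-right : ∀ {x y z n} → 2 + n ≤ dist x z → dist x y ≤ n → 2 ≤ dist y z
  apart-right {x} {y} {z} {n} 2+n≤xz xy≤n = +-cancelˡ-≤ n 2 (dist y z) (begin
    n + 2               ≡⟨ +-comm n 2 ⟩
    2 + n               ≤⟨ 2+n≤xz ⟩
    dist x z            ≤⟨ dist-triangle x y z ⟩
    dist x y + dist y z ≤⟨ +-monoˡ-≤ (dist y z) xy≤n ⟩
    n + dist y z        ∎)
    where open ≤-Reasoning

  dist≡2 : ∀ {x y z} → Adj G x y → Adj G y z → 2 ≤ dist x z → dist x z ≡ 2
  dist≡2 xy yz 2≤xz = ≤-antisym (dist-≤ (step xy (step yz here))) 2≤xz

  dist-via-neighbours : ∀ {x x′ w′ w m} → Adj G x x′ → Adj G w′ w →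
    dist x′ w′ ≡ m → dist x w ≡ 2 + m → dist x w′ ≡ 1 + m
  dist-via-neighbours {x} {x′} {w′} {w} {m} xx′ w′w x′w′ xw = ≤-antisym upper lower
    where
    upper : dist x w′ ≤ 1 + m
    upper = ≤-trans (adj⇒dist≤1+ w′ xx′) (s≤s (≤-reflexive x′w′))
    lower : 1 + m ≤ dist x w′
    lower = +-cancelʳ-≤ 1 (1 + m) (dist x w′) (begin
      1 + m + 1              ≡⟨ +-comm (1 + m) 1 ⟩
      2 + m                  ≡⟨ xw ⟨
      dist x w               ≤⟨ dist-triangle x w′ w ⟩
      dist x w′ + dist w′ w  ≡⟨ cong (dist x w′ +_) (adj⇒dist≡1 w′w) ⟩
      dist x w′ + 1          ∎)
      where open ≤-Reasoning

  split-geodesic : ∀ i {j x z} → dist x z ≡ i + j → Σ (V G) λ w → dist x w ≡ i × dist w z ≡ j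
  split-geodesic i {j} {x} {z} eq with splitAt i (subst (Walk G x z) eq geodesic)
  ... | w , w₁ , w₂ = w , ≤-sum-tight (dist-≤ w₁) (dist-≤ w₂) i+j≤
    where
    i+j≤ : i + j ≤ dist x w + dist w z
    i+j≤ = subst (_≤ dist x w + dist w z) eq (dist-triangle x w z)

  first-step : ∀ {x z} → 1 ≤ dist x z → Σ (V G) λ w → Adj G x w × suc (dist w z) ≡ dist x z
  first-step 1≤xz with m≤n⇒∃[o]m+o≡n 1≤xz
  ... | j , 1+j≡xz with split-geodesic 1 (≡.sym 1+j≡xz)
  ...   | w , xw≡1 , wz≡j = w , dist≡1⇒adj xw≡1 , ≡.trans (cong suc wz≡j) 1+j≡xz

  last-step : ∀ {x z} → 1 ≤ dist x z → Σ (V G) λ w → Adj G w z × suc (dist x w) ≡ dist x z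
  last-step 1≤xz with m≤n⇒∃[o]m+o≡n 1≤xz
  ... | j , 1+j≡xz with split-geodesic j (≡.trans (≡.sym 1+j≡xz) (+-comm 1 j))
  ...   | w , xw≡j , wz≡1 = w , dist≡1⇒adj wz≡1 , ≡.trans (cong suc xw≡j) 1+j≡xz

  isometric-C4 : ∀ {v₀ v₁ v₂ v₃} → Adj G v₀ v₁ → Adj G v₁ v₂ → Adj G v₂ v₃ → Adj G v₃ v₀ →
    2 ≤ dist v₀ v₂ → 2 ≤ dist v₁ v₃ → IsometricC4 G
  isometric-C4 {v₀} {v₁} {v₂} {v₃} e₀₁ e₁₂ e₂₃ e₃₀ 2≤d₀₂ 2≤d₁₃ = record
    { f = f ; inj = injective ; edges = edges ; isometric = λ i j → ≡⇒Dist (distances i j) }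
    where
    f : Fin 4 → V G
    f zero                   = v₀
    f (suc zero)             = v₁
    f (suc (suc zero))       = v₂
    f (suc (suc (suc zero))) = v₃

    edges : ∀ {i j} → C4Adj i j → Adj G (f i) (f j)
    edges e01 = e₀₁
    edges e12 = e₁₂
    edges e23 = e₂₃
    edges e30 = e₃₀

    d₀₂ : dist v₀ v₂ ≡ 2
    d₀₂ = dist≡2 e₀₁ e₁₂ 2≤d₀₂
    d₁₃ : dist v₁ v₃ ≡ 2
    d₁₃ = dist≡2 e₁₂ e₂₃ 2≤d₁₃
    edge : ∀ {x y} → Adj G x y → dist y x ≡ 1
    edge e = adj⇒dist≡1 (Graph.sym G e)
    diagonal : ∀ {x y} → dist x y ≡ 2 → dist y x ≡ 2
    diagonal eq = ≡.trans (dist-sym _ _) eq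

    distances : ∀ i j → dist (f i) (f j) ≡ dC4 i j
    distances zero                   zero                   = dist-refl
    distances zero                   (suc zero)             = adj⇒dist≡1 e₀₁
    distances zero                   (suc (suc zero))       = d₀₂
    distances zero                   (suc (suc (suc zero))) = edge e₃₀
    distances (suc zero)             zero                   = edge e₀₁
    distances (suc zero)             (suc zero)             = dist-refl
    distances (suc zero)             (suc (suc zero))       = adj⇒dist≡1 e₁₂
    distances (suc zero)             (suc (suc (suc zero))) = d₁₃
    distances (suc (suc zero))       zero                   = diagonal d₀₂
    distances (suc (suc zero))       (suc zero)             = edge e₁₂
    distances (suc (suc zero))       (suc (suc zero))       = dist-refl
    distances (suc (suc zero))       (suc (suc (suc zero))) = adj⇒dist≡1 e₂₃
    distances (suc (suc (suc zero))) zero                   = adj⇒dist≡1 e₃₀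
    distances (suc (suc (suc zero))) (suc zero)             = diagonal d₁₃
    distances (suc (suc (suc zero))) (suc (suc zero))       = edge e₂₃
    distances (suc (suc (suc zero))) (suc (suc (suc zero))) = dist-refl

    injective : ∀ {i j} → f i ≡ f j → i ≡ j
    injective {i} {j} eq = dC4≡0⇒≡ i j (≡.trans (≡.sym (distances i j)) fi-fj≡0)
      where
      fi-fj≡0 : dist (f i) (f j) ≡ 0
      fi-fj≡0 = subst (λ y → dist (f i) y ≡ 0) eq dist-refl

  -- Quadrangles

  -- A quadruple with twice δ ≥ k, labelled so that the diagonal sum d(a,c) + d(b,d) is the largest
  -- of the three pair sums.
  record Quadrangle (k : ℕ) : Set where
    field
      a b c d : V G
      sides₁ : dist a b + dist c d + k ≤ dist a c + dist b d
      sides₂ : dist a d + dist b c + k ≤ dist a c + dist b d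

  rotate : ∀ {k} → Quadrangle k → Quadrangle k
  rotate {k} q = record
    { a = b ; b = c ; c = d ; d = a
    ; sides₁ = subst₂ (λ s t → s + k ≤ t) bc+da diagonals sides₂
    ; sides₂ = subst₂ (λ s t → s + k ≤ t) (cong (_+ dist c d) (dist-sym a b)) diagonals sides₁
    }
    where
    open Quadrangle q
    bc+da : dist a d + dist b c ≡ dist b c + dist d a
    bc+da = ≡.trans (+-comm (dist a d) (dist b c)) (cong (dist b c +_) (dist-sym a d))
    diagonals : dist a c + dist b d ≡ dist b d + dist c a
    diagonals = ≡.trans (+-comm (dist a c) (dist b d)) (cong (dist b d +_) (dist-sym a c))

  reflect : ∀ {k} → Quadrangle k → Quadrangle k
  reflect {k} q = record
    { a = a ; b = d ; c = c ; d = b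
    ; sides₁ = subst₂ (λ s t → s + k ≤ t) (cong (dist a d +_) (dist-sym b c)) diagonals sides₂
    ; sides₂ = subst₂ (λ s t → s + k ≤ t) (cong (dist a b +_) (dist-sym c d)) diagonals sides₁
    }
    where
    open Quadrangle q
    diagonals : dist a c + dist b d ≡ dist a c + dist d b
    diagonals = cong (dist a c +_) (dist-sym b d)

  diagonal-apart : ∀ {k} (q : Quadrangle (2 + k)) → let open Quadrangle q in 2 ≤ dist a c
  diagonal-apart {k} q = half (+-cancelʳ-≤ (S₁ + S₂) 4 (ac + ac) (begin
    4 + (S₁ + S₂)            ≡⟨ shuffle₁ S₁ S₂ ⟩
    S₁ + 2 + (S₂ + 2)        ≤⟨ +-mono-≤ (dominate sides₁) (dominate sides₂) ⟩
    ac + bd + (ac + bd)      ≡⟨ interchange ac bd ac bd ⟩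
    ac + ac + (bd + bd)      ≤⟨ +-monoʳ-≤ (ac + ac) bd+bd≤ ⟩
    ac + ac + (S₁ + S₂)      ∎))
    where
    open Quadrangle q
    open ≤-Reasoning
    shuffle₁ : ∀ s t → 4 + (s + t) ≡ s + 2 + (t + 2)
    shuffle₁ = solve-∀
    shuffle₂ : ∀ p q r s → p + q + (r + s) ≡ p + s + (q + r)
    shuffle₂ = solve-∀
    half : ∀ {n} → 4 ≤ n + n → 2 ≤ n
    half {suc (suc n)} _ = s≤s (s≤s z≤n)
    half {1} (s≤s (s≤s ()))
    S₁ = dist a b + dist c d
    S₂ = dist a d + dist b c
    ac = dist a c
    bd = dist b d
    dominate : ∀ {S} → S + (2 + k) ≤ ac + bd → S + 2 ≤ ac + bd
    dominate {S} = ≤-trans (+-monoʳ-≤ S (m≤m+n 2 k))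
    bd≤ab+ad : dist b d ≤ dist a b + dist a d
    bd≤ab+ad = subst (λ ba → dist b d ≤ ba + dist a d) (dist-sym b a) (dist-triangle b a d)
    bd+bd≤ : dist b d + dist b d ≤ S₁ + S₂
    bd+bd≤ = ≤-trans (+-mono-≤ bd≤ab+ad (dist-triangle b c d))
                     (≤-reflexive (shuffle₂ (dist a b) (dist a d) (dist b c) (dist c d)))

  record SidesApart {k} (q : Quadrangle k) : Set where
    constructor sides-apart
    open Quadrangle q
    field
      ab : 2 ≤ dist a b
      bc : 2 ≤ dist b c
      cd : 2 ≤ dist c d
      da : 2 ≤ dist d a

  rotate-apart : ∀ {k} {q : Quadrangle k} → SidesApart q → SidesApart (rotate q)
  rotate-apart (sides-apart ab bc cd da) = sides-apart bc cd da ab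

  quadrangle-of : ∀ {k} x y u v →
    Dominant k (dist u v + dist x y) (dist u x + dist v y) (dist u y + dist v x) → Quadrangle k
  quadrangle-of {k} x y u v (first s₂ s₃) = record
    { a = u ; b = x ; c = v ; d = y
    ; sides₁ = s₂
    ; sides₂ = subst (λ xv → dist u y + xv + k ≤ dist u v + dist x y) (dist-sym v x) s₃
    }
  quadrangle-of x y u v (second s₁ s₃) = record
    { a = u ; b = v ; c = x ; d = y ; sides₁ = s₁ ; sides₂ = s₃ }
  quadrangle-of {k} x y u v (third s₁ s₂) = record
    { a = u ; b = v ; c = y ; d = x
    ; sides₁ = subst (λ yx → dist u v + yx + k ≤ dist u y + dist v x) (dist-sym x y) s₁
    ; sides₂ = s₂
    }

  hyperbolic-unless : ∀ k → ¬ Quadrangle (suc k) → HalfHyperbolic G k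
  hyperbolic-unless k none x y u v _ _ _ _ _ _ Dxy Duv Dux Dvy Duy Dvx
    with Dist⇒≡ Dxy | Dist⇒≡ Duv | Dist⇒≡ Dux | Dist⇒≡ Dvy | Dist⇒≡ Duy | Dist⇒≡ Dvx
  ... | refl | refl | refl | refl | refl | refl
    with suc k ≤? twiceδ (dist u v + dist x y) (dist u x + dist v y) (dist u y + dist v x)
  ...   | no  δ≤k = ≮⇒≥ δ≤k
  ...   | yes k<δ = ⊥-elim (none (quadrangle-of x y u v (twiceδ-dominant k _ _ _ k<δ)))

  close-side : ∀ {k} (q : Quadrangle k) → let open Quadrangle q in
    dist a b ≤ 1 → dist a c ≤ suc (dist b c) × dist b d ≤ suc (dist a d)
  close-side q ab≤1 =
    ≤-trans (dist-triangle a b c) (+-monoˡ-≤ (dist b c) ab≤1) ,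
    ≤-trans (dist-triangle b a d) (+-monoˡ-≤ (dist a d) (subst (_≤ 1) (dist-sym a b) ab≤1))
    where open Quadrangle q

  side-apart₃ : (q : Quadrangle 3) → let open Quadrangle q in 2 ≤ dist a b
  side-apart₃ q = decidable-stable (2 ≤? dist a b) λ 2≰ab →
    let (ac≤ , bd≤) = close-side q (≰2⇒≤1 2≰ab) in
    m+3≰m+2 (dist a d + dist b c) (begin
      dist a d + dist b c + 3          ≤⟨ sides₂ ⟩
      dist a c + dist b d              ≤⟨ +-mono-≤ ac≤ bd≤ ⟩
      suc (dist b c) + suc (dist a d)  ≡⟨ shuffle (dist b c) (dist a d) ⟩
      dist a d + dist b c + 2          ∎)
    where
    open Quadrangle q
    open ≤-Reasoning
    shuffle : ∀ x y → suc x + suc y ≡ y + x + 2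
    shuffle = solve-∀

  record UnitSide (q : Quadrangle 2) : Set where
    open Quadrangle q
    field
      adjacent  : Adj G a b
      ac≡1+bc   : dist a c ≡ suc (dist b c)
      bd≡1+ad   : dist b d ≡ suc (dist a d)
      cd<ad+bc  : dist c d < dist a d + dist b c

  unit-side : (q : Quadrangle 2) → let open Quadrangle q in dist a b ≤ 1 → UnitSide q
  unit-side q ab≤1 = record
    { adjacent = dist≡1⇒adj ab≡1 ; ac≡1+bc = ac≡1+bc ; bd≡1+ad = bd≡1+ad ; cd<ad+bc = cd<ad+bc }
    where
    open Quadrangle q
    open ≤-Reasoning
    shuffle : ∀ x y → suc x + suc y ≡ y + x + 2
    shuffle = solve-∀
    tight : dist a c ≡ suc (dist b c) × dist b d ≡ suc (dist a d)
    tight = ≤-sum-tight (proj₁ (close-side q ab≤1)) (proj₂ (close-side q ab≤1)) (begin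
      suc (dist b c) + suc (dist a d)  ≡⟨ shuffle (dist b c) (dist a d) ⟩
      dist a d + dist b c + 2          ≤⟨ sides₂ ⟩
      dist a c + dist b d              ∎)
    ac≡1+bc = proj₁ tight
    bd≡1+ad = proj₂ tight
    ab≡1 : dist a b ≡ 1
    ab≡1 = ≤-antisym ab≤1 (+-cancelʳ-≤ (dist b c) 1 (dist a b)
             (≤-trans (≤-reflexive (≡.sym ac≡1+bc)) (dist-triangle a b c)))
    cd<ad+bc : dist c d < dist a d + dist b c
    cd<ad+bc = +-cancelʳ-≤ 2 (suc (dist c d)) (dist a d + dist b c) (begin
      suc (dist c d) + 2               ≡⟨ cong (λ ab → ab + dist c d + 2) ab≡1 ⟨
      dist a b + dist c d + 2          ≤⟨ sides₁ ⟩
      dist a c + dist b d              ≡⟨ ≡.cong₂ _+_ ac≡1+bc bd≡1+ad ⟩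
      suc (dist b c) + suc (dist a d)  ≡⟨ shuffle (dist b c) (dist a d) ⟩
      dist a d + dist b c + 2          ∎)

  -- Transitive orientations of the complement

  complement-sym : ∀ {x y} → ComplementEdge G x y → ComplementEdge G y x
  complement-sym (x≢y , ¬xy) = (λ y≡x → x≢y (≡.sym y≡x)) , (λ yx → ¬xy (Graph.sym G yx))

  converse : TransitiveOrientationOfComplement G → TransitiveOrientationOfComplement G
  converse T = record
    { Arc      = λ x y → Arc y x
    ; arc-edge = λ yx → complement-sym (arc-edge yx)
    ; orient   = λ xy → swap (orient xy)
    ; antisym  = antisym
    ; trans    = λ xy yz → trans yz xy
    }
    where open TransitiveOrientationOfComplement T

  module Betweenness (T : TransitiveOrientationOfComplement G) where
    open TransitiveOrientationOfComplement T renaming (trans to arc-trans)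

    arc⇒¬adj : ∀ {x y} → Arc x y → ¬ Adj G x y
    arc⇒¬adj xy = proj₂ (arc-edge xy)

    step-below : ∀ {a b q} → Arc a b → Adj G a q → q ≡ b ⊎ Adj G q b ⊎ Arc q b
    step-below {a} {b} {q} ab aq with em {q ≡ b} | em {Adj G q b}
    ... | yes q≡b | _      = inj₁ q≡b
    ... | no _    | yes qb = inj₂ (inj₁ qb)
    ... | no q≢b  | no ¬qb with orient (q≢b , ¬qb)
    ...   | inj₁ qb = inj₂ (inj₂ qb)
    ...   | inj₂ bq = ⊥-elim (arc⇒¬adj (arc-trans ab bq) aq)

    walk-between-sum : ∀ {a b c k} → Arc a b → Arc b c → Walk G a c k → dist a b + dist b c ≤ k + 2
    walk-between-sum ab bc here = ⊥-elim (antisym ab bc)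
    walk-between-sum {k = suc k} ab bc (step aq w) with step-below ab aq
    ... | inj₁ refl      = ≤-trans (+-mono-≤ (dist-≤ (step aq here)) (dist-≤ w)) (m≤m+n (suc k) 2)
    ... | inj₂ (inj₁ qb) =
      ≤-trans (+-mono-≤ (dist-≤ (step aq (step qb here))) (dist-≤ (step (Graph.sym G qb) w)))
              (≤-reflexive (+-comm 2 (suc k)))
    ... | inj₂ (inj₂ qb) = ≤-trans (+-monoˡ-≤ _ (adj⇒dist≤1+ _ aq)) (s≤s (walk-between-sum qb bc w))

    walk-between-left : ∀ {a b c k} → Arc a b → Arc b c → Walk G a c k → dist a b ≤ k
    walk-between-left ab bc here = ⊥-elim (antisym ab bc)
    walk-between-left ab bc (step aq w) with step-below ab aq | w
    ... | inj₁ refl      | _        = ≤-trans (dist-≤ {n = 1} (step aq here)) (s≤s z≤n)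
    ... | inj₂ (inj₁ qb) | here     = ⊥-elim (arc⇒¬adj bc (Graph.sym G qb))
    ... | inj₂ (inj₁ qb) | step _ _ = ≤-trans (dist-≤ {n = 2} (step aq (step qb here))) (s≤s (s≤s z≤n))
    ... | inj₂ (inj₂ qb) | _        = ≤-trans (adj⇒dist≤1+ _ aq) (s≤s (walk-between-left qb bc w))

    between-sum : ∀ {a b c} → Arc a b → Arc b c → dist a b + dist b c ≤ dist a c + 2
    between-sum ab bc = walk-between-sum ab bc geodesic

    between-left : ∀ {a b c} → Arc a b → Arc b c → dist a b ≤ dist a c
    between-left ab bc = walk-between-left ab bc geodesic

  module Orientation (T : TransitiveOrientationOfComplement G) where
    open TransitiveOrientationOfComplement T public renaming (trans to arc-trans)
    open Betweenness T public

    between-right : ∀ {a b c} → Arc a b → Arc b c → dist b c ≤ dist a c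
    between-right {a} {b} {c} ab bc =
      subst₂ _≤_ (dist-sym c b) (dist-sym c a) (Betweenness.between-left (converse T) bc ab)

    arc⇒apart : ∀ {x y} → Arc x y → 2 ≤ dist x y
    arc⇒apart xy = complement⇒apart (arc-edge xy)

    orient-apart : ∀ {x y} → 2 ≤ dist x y → Arc x y ⊎ Arc y x
    orient-apart 2≤xy = orient (apart⇒complement 2≤xy)

    arc-unless : ∀ {x y} → 2 ≤ dist x y → ¬ Arc y x → Arc x y
    arc-unless 2≤xy ¬yx with orient-apart 2≤xy
    ... | inj₁ xy = xy
    ... | inj₂ yx = ⊥-elim (¬yx yx)

    adjacent-unless : ∀ {x y} → x ≢ y → ¬ Arc x y → ¬ Arc y x → Adj G x y
    adjacent-unless {x} {y} x≢y ¬xy ¬yx with em {Adj G x y}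
    ... | yes e = e
    ... | no ¬e with orient (x≢y , ¬e)
    ...   | inj₁ xy = ⊥-elim (¬xy xy)
    ...   | inj₂ yx = ⊥-elim (¬yx yx)

    adjacent-to-between : ∀ {a b c w} → Arc a b → Arc b c →
      dist a w < dist a b → dist w c < dist b c → Adj G w b
    adjacent-to-between {a} {b} {c} {w} ab bc aw<ab wc<bc = adjacent-unless w≢b ¬wb ¬bw
      where
      w≢b : w ≢ b
      w≢b refl = <-irrefl refl aw<ab
      ¬wb : ¬ Arc w b
      ¬wb wb = <⇒≱ wc<bc (between-right wb bc)
      ¬bw : ¬ Arc b w
      ¬bw bw = <⇒≱ aw<ab (between-left ab bw)

    arc-toward : ∀ {x y z} → Arc x z → 2 + dist y z ≤ dist x z → Arc x y
    arc-toward xz 2+yz≤xz = arc-unless (apart-left 2+yz≤xz ≤-refl) λ yx →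
      <⇒≱ (≤-trans (n≤1+n _) 2+yz≤xz) (between-right yx xz)

    arc-from-neighbour : ∀ {a b c} → Adj G a b → 2 ≤ dist b c → Arc a c → Arc b c
    arc-from-neighbour ab 2≤bc ac = arc-unless 2≤bc λ cb → arc⇒¬adj (arc-trans ac cb) ab

    arc-to-neighbour : ∀ {a b c} → Adj G a b → 2 ≤ dist c b → Arc c a → Arc c b
    arc-to-neighbour ab 2≤cb ca = arc-unless 2≤cb λ bc → arc⇒¬adj (arc-trans bc ca) (Graph.sym G ab)

    ¬apart-from-common-neighbour : ∀ {a b c d} → Arc a d → Arc d c → Adj G a b → Adj G b c →
      ¬ 2 ≤ dist b d
    ¬apart-from-common-neighbour a→d d→c ab bc 2≤bd with orient-apart 2≤bd
    ... | inj₁ b→d = arc⇒¬adj (arc-trans b→d d→c) bc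
    ... | inj₂ d→b = arc⇒¬adj (arc-trans a→d d→b) ab

    tight-detour : ∀ {a b c} → Arc a b → Arc b c → dist a c + 2 ≤ dist a b + dist b c →
      Σ (V G) λ y → Adj G y b × suc (dist a y) ≡ dist a b × suc (dist y c) ≡ dist b c
    tight-detour {a} {b} {c} ab bc ac+2≤ = detour (m≤n⇒∃[o]m+o≡n (<⇒≤ (arc⇒apart ab)))
                                                  (m≤n⇒∃[o]m+o≡n (<⇒≤ (arc⇒apart bc)))
      where
      ac≡ : ∀ {i j} → suc i ≡ dist a b → suc j ≡ dist b c → dist a c ≡ i + j
      ac≡ {i} {j} 1+i≡ab 1+j≡bc = +-cancelʳ-≡ 2 (dist a c) (i + j) (begin
        dist a c + 2         ≡⟨ ≤-antisym ac+2≤ (between-sum ab bc) ⟩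
        dist a b + dist b c  ≡⟨ ≡.cong₂ _+_ 1+i≡ab 1+j≡bc ⟨
        suc i + suc j        ≡⟨ shuffle i j ⟩
        i + j + 2            ∎)
        where
        open ≡.≡-Reasoning
        shuffle : ∀ i j → suc i + suc j ≡ i + j + 2
        shuffle = solve-∀
      detour : (∃ λ i → suc i ≡ dist a b) → (∃ λ j → suc j ≡ dist b c) →
        Σ (V G) λ y → Adj G y b × suc (dist a y) ≡ dist a b × suc (dist y c) ≡ dist b c
      detour (i , 1+i≡ab) (j , 1+j≡bc) with split-geodesic i (ac≡ 1+i≡ab 1+j≡bc)
      ... | y , ay≡i , yc≡j =
        y , adjacent-to-between ab bc (≤-reflexive 1+ay≡ab) (≤-reflexive 1+yc≡bc) , 1+ay≡ab , 1+yc≡bc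
        where
        1+ay≡ab = ≡.trans (cong suc ay≡i) 1+i≡ab
        1+yc≡bc = ≡.trans (cong suc yc≡j) 1+j≡bc

    crossing≤nested+2 : ∀ {p₁ p₂ p₃ p₄} → Arc p₁ p₂ → Arc p₂ p₃ → Arc p₃ p₄ →
      dist p₁ p₃ + dist p₂ p₄ ≤ dist p₁ p₄ + dist p₂ p₃ + 2
    crossing≤nested+2 {p₁} {p₂} {p₃} {p₄} a₁₂ a₂₃ a₃₄ = begin
      d₁₃ + d₂₄          ≤⟨ +-monoʳ-≤ d₁₃ (dist-triangle p₂ p₃ p₄) ⟩
      d₁₃ + (d₂₃ + d₃₄)  ≡⟨ x∙yz≈y∙xz d₁₃ d₂₃ d₃₄ ⟩
      d₂₃ + (d₁₃ + d₃₄)  ≤⟨ +-monoʳ-≤ d₂₃ (between-sum (arc-trans a₁₂ a₂₃) a₃₄) ⟩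
      d₂₃ + (d₁₄ + 2)    ≡⟨ x∙yz≈yx∙z d₂₃ d₁₄ 2 ⟩
      d₁₄ + d₂₃ + 2      ∎
      where
      open ≤-Reasoning
      d₁₃ = dist p₁ p₃ ; d₂₄ = dist p₂ p₄ ; d₂₃ = dist p₂ p₃ ; d₃₄ = dist p₃ p₄ ; d₁₄ = dist p₁ p₄

    nested≤crossing+2 : ∀ {p₁ p₂ p₃ p₄} → Arc p₂ p₃ → Arc p₃ p₄ →
      dist p₁ p₄ + dist p₂ p₃ ≤ dist p₁ p₃ + dist p₂ p₄ + 2
    nested≤crossing+2 {p₁} {p₂} {p₃} {p₄} a₂₃ a₃₄ = begin
      d₁₄ + d₂₃          ≤⟨ +-monoˡ-≤ d₂₃ (dist-triangle p₁ p₃ p₄) ⟩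
      d₁₃ + d₃₄ + d₂₃    ≡⟨ xy∙z≈x∙zy d₁₃ d₃₄ d₂₃ ⟩
      d₁₃ + (d₂₃ + d₃₄)  ≤⟨ +-monoʳ-≤ d₁₃ (between-sum a₂₃ a₃₄) ⟩
      d₁₃ + (d₂₄ + 2)    ≡⟨ +-assoc d₁₃ d₂₄ 2 ⟨
      d₁₃ + d₂₄ + 2      ∎
      where
      open ≤-Reasoning
      d₁₃ = dist p₁ p₃ ; d₂₄ = dist p₂ p₄ ; d₂₃ = dist p₂ p₃ ; d₃₄ = dist p₃ p₄ ; d₁₄ = dist p₁ p₄

    consecutive≤crossing : ∀ {p₁ p₂ p₃ p₄} → Arc p₁ p₂ → Arc p₂ p₃ → Arc p₃ p₄ →
      dist p₁ p₂ + dist p₃ p₄ ≤ dist p₁ p₃ + dist p₂ p₄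
    consecutive≤crossing a₁₂ a₂₃ a₃₄ = +-mono-≤ (between-left a₁₂ a₂₃) (between-right a₂₃ a₃₄)

    data ChainQuadrangle (k : ℕ) : Set where
      consecutive : ∀ {p₁ p₂ p₃ p₄} → Arc p₁ p₂ → Arc p₂ p₃ → Arc p₃ p₄ →
        dist p₁ p₃ + dist p₂ p₄ + k ≤ dist p₁ p₂ + dist p₃ p₄ → ChainQuadrangle k
      crossing : ∀ {p₁ p₂ p₃ p₄} → Arc p₁ p₂ → Arc p₂ p₃ → Arc p₃ p₄ →
        dist p₁ p₄ + dist p₂ p₃ + k ≤ dist p₁ p₃ + dist p₂ p₄ → ChainQuadrangle k
      nested : ∀ {p₁ p₂ p₃ p₄} → Arc p₁ p₂ → Arc p₂ p₃ → Arc p₃ p₄ →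
        dist p₁ p₃ + dist p₂ p₄ + k ≤ dist p₁ p₄ + dist p₂ p₃ → ChainQuadrangle k

    no-consecutive-chain : ∀ {k p₁ p₂ p₃ p₄} → Arc p₁ p₂ → Arc p₂ p₃ → Arc p₃ p₄ →
      ¬ (dist p₁ p₃ + dist p₂ p₄ + suc k ≤ dist p₁ p₂ + dist p₃ p₄)
    no-consecutive-chain a₁₂ a₂₃ a₃₄ h = m+1+n≰m _ (≤-trans h (consecutive≤crossing a₁₂ a₂₃ a₃₄))

    no-chain-quadrangle₃ : ¬ ChainQuadrangle 3
    no-chain-quadrangle₃ (consecutive a₁₂ a₂₃ a₃₄ h) = no-consecutive-chain a₁₂ a₂₃ a₃₄ h
    no-chain-quadrangle₃ (crossing a₁₂ a₂₃ a₃₄ h) = m+3≰m+2 _ (≤-trans h (crossing≤nested+2 a₁₂ a₂₃ a₃₄))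
    no-chain-quadrangle₃ (nested a₁₂ a₂₃ a₃₄ h)   = m+3≰m+2 _ (≤-trans h (nested≤crossing+2 a₂₃ a₃₄))

    ordered-chain : ∀ {k} (q : Quadrangle k) → let open Quadrangle q in
      Arc a c → Arc b d → Arc a b → 2 ≤ dist b c → 2 ≤ dist c d → ChainQuadrangle k
    ordered-chain q ac bd ab 2≤bc 2≤cd with orient-apart 2≤bc
    ... | inj₂ cb = consecutive ac cb bd (Quadrangle.sides₁ q)
    ... | inj₁ bc with orient-apart 2≤cd
    ...   | inj₁ cd = crossing ab bc cd (Quadrangle.sides₂ q)
    ...   | inj₂ dc = nested ab bd dc (Quadrangle.sides₂ q)

    diagonals-chain : ∀ {k} (q : Quadrangle k) → SidesApart q → let open Quadrangle q in
      Arc a c → Arc b d → ChainQuadrangle k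
    diagonals-chain q (sides-apart ab bc cd da) ac bd with orient-apart ab
    ... | inj₁ a→b = ordered-chain q ac bd a→b bc cd
    ... | inj₂ b→a = ordered-chain (reflect (rotate q)) bd ac b→a (apart-sym da) (apart-sym cd)

    diagonal-chain : ∀ {k} (q : Quadrangle (2 + k)) → SidesApart q → let open Quadrangle q in
      Arc a c → ChainQuadrangle (2 + k)
    diagonal-chain q apart ac with orient-apart (diagonal-apart (rotate q))
    ... | inj₁ bd = diagonals-chain q apart ac bd
    ... | inj₂ db = diagonals-chain (rotate (rotate (rotate q)))
                                    (rotate-apart (rotate-apart (rotate-apart apart))) db ac

    quadrangle-chain : ∀ {k} (q : Quadrangle (2 + k)) → SidesApart q → ChainQuadrangle (2 + k)
    quadrangle-chain q apart with orient-apart (diagonal-apart q)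
    ... | inj₁ ac = diagonal-chain q apart ac
    ... | inj₂ ca = diagonal-chain (rotate (rotate q)) (rotate-apart (rotate-apart apart)) ca

    ladder-rung : ∀ {n y t z s z′ s′} → Arc t s → Adj G y t → Adj G z s → Adj G z′ z → Adj G s′ s →
      dist t z ≡ 2 + n → dist y z ≡ 3 + n → dist t s ≡ 3 + n →
      dist t z′ ≡ 1 + n → dist y z′ ≡ 2 + n → dist y s′ ≡ 1 + n → Adj G z′ s′
    ladder-rung {n} {y} {t} {z} {s} {z′} {s′} t→s yt zs z′z s′s tz yz ts tz′ yz′ ys′ =
      Graph.sym G (adjacent-to-between y→z′ z′→s ys′<yz′ s′s<z′s)
      where
      t→z : Arc t z
      t→z = arc-unless (≡2+⇒2≤ tz) λ zt → arc⇒¬adj (arc-trans zt t→s) zs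
      y→z : Arc y z
      y→z = arc-unless (≡2+⇒2≤ yz) λ zy → arc⇒¬adj (arc-trans t→z zy) (Graph.sym G yt)
      y→z′ : Arc y z′
      y→z′ = arc-unless (≡2+⇒2≤ yz′) λ z′y → arc⇒¬adj (arc-trans z′y y→z) z′z
      2≤z′s : 2 ≤ dist z′ s
      2≤z′s = apart-right (≤-reflexive (≡.sym ts)) (≤-reflexive tz′)
      z′→s : Arc z′ s
      z′→s = arc-unless 2≤z′s λ sz′ →
        <⇒≱ (≤-trans (≤-reflexive (cong suc tz′)) (≤-trans (n≤1+n _) (≤-reflexive (≡.sym ts))))
            (between-left t→s sz′)
      ys′<yz′ : dist y s′ < dist y z′
      ys′<yz′ = ≤-reflexive (≡.trans (cong suc ys′) (≡.sym yz′))
      s′s<z′s : dist s′ s < dist z′ s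
      s′s<z′s = ≤-trans (≤-reflexive (cong suc (adj⇒dist≡1 s′s))) 2≤z′s

    tripod-core : ∀ {n a b c d} → Adj G a b → Adj G b c → Arc a c → Arc c d →
      dist a c ≡ 2 → dist a d ≡ suc n → dist c d ≡ suc n → dist b d ≡ 2 + n → IsometricC4 G
    tripod-core {n} {a} {b} {c} {d} ab bc a→c c→d ac ad cd bd
      with first-step (≡1+⇒1≤ ad)
    ... | g , ag , 1+gd≡ad = isometric-C4 ab bc (Graph.sym G gc) (Graph.sym G ag) (≡2+⇒2≤ ac) 2≤bg
      where
      gd≡n : dist g d ≡ n
      gd≡n = suc-injective (≡.trans 1+gd≡ad ad)
      gc : Adj G g c
      gc = adjacent-to-between a→c c→d (≤-reflexive (≡.trans (cong suc (adj⇒dist≡1 ag)) (≡.sym ac)))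
                                       (≤-reflexive (≡.trans (cong suc gd≡n) (≡.sym cd)))
      2≤bg : 2 ≤ dist b g
      2≤bg = apart-left (≤-reflexive (≡.sym bd)) (≤-reflexive gd≡n)

    one-same : ∀ {a b c d} → Adj G a b → Arc a c → Arc b d → 2 ≤ dist a d → 2 ≤ dist b c →
      dist b d ≡ suc (dist a d) → dist a c ≡ suc (dist b c) → IsometricC4 G
    one-same ab a→c b→d 2≤ad 2≤bc bd ac with first-step (<⇒≤ 2≤ad) | first-step (<⇒≤ 2≤bc)
    ... | a′ , aa′ , 1+a′d≡ad | b′ , bb′ , 1+b′c≡bc =
      isometric-C4 ab bb′ (Graph.sym G a′b′) (Graph.sym G aa′) (arc⇒apart a→b′) (arc⇒apart b→a′)
      where
      b→a′ : Arc _ a′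
      b→a′ = arc-toward b→d (≤-reflexive (≡.trans (cong suc 1+a′d≡ad) (≡.sym bd)))
      a→b′ : Arc _ b′
      a→b′ = arc-toward a→c (≤-reflexive (≡.trans (cong suc 1+b′c≡bc) (≡.sym ac)))
      a′b′ : Adj G a′ b′
      a′b′ = adjacent-unless (λ { refl → arc⇒¬adj a→b′ aa′ })
                             (λ a′→b′ → arc⇒¬adj (arc-trans b→a′ a′→b′) bb′)
                             (λ b′→a′ → arc⇒¬adj (arc-trans a→b′ b′→a′) aa′)

    one-cross : ∀ {a b c d} → Adj G a b → Arc c a → Arc a d → Arc c b → Arc b d →
      dist c a ≡ suc (dist c b) → dist b d ≡ suc (dist a d) → dist c d < dist a d + dist c b →
      IsometricC4 G
    one-cross {a} {b} {c} {d} ab c→a a→d c→b b→d ca bd cd<ad+cb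
      with m≤n⇒∃[o]m+o≡n (<⇒≤ (arc⇒apart c→b))
    ... | α , 1+α≡cb with m≤n⇒∃[o]m+o≡n (≤-trans (≤-reflexive 1+α≡cb) (between-left c→b b→d))
    ...   | r , 1+α+r≡cd with split-geodesic α (≡.trans (≡.sym 1+α+r≡cd) (≡.sym (+-suc α r)))
    ...     | h , ch≡α , hd≡1+r with first-step (≡1+⇒1≤ hd≡1+r)
    ...       | h′ , hh′ , 1+h′d≡hd = isometric-C4 (Graph.sym G hb) hh′ h′a ab 2≤bh′ 2≤ha
      where
      h′d≡r : dist h′ d ≡ r
      h′d≡r = suc-injective (≡.trans 1+h′d≡hd hd≡1+r)
      r<ad : r < dist a d
      r<ad = +-cancelˡ-≤ (suc α) (suc r) (dist a d) (begin
        suc α + suc r        ≡⟨ cong suc (+-suc α r) ⟩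
        suc (suc α + r)      ≡⟨ cong suc 1+α+r≡cd ⟩
        suc (dist c d)       ≤⟨ cd<ad+cb ⟩
        dist a d + dist c b  ≡⟨ +-comm (dist a d) (dist c b) ⟩
        dist c b + dist a d  ≡⟨ cong (_+ dist a d) 1+α≡cb ⟨
        suc α + dist a d     ∎)
        where open ≤-Reasoning
      ch′≤cb : dist c h′ ≤ dist c b
      ch′≤cb = begin
        dist c h′             ≤⟨ dist-triangle c h h′ ⟩
        dist c h + dist h h′  ≡⟨ ≡.cong₂ _+_ ch≡α (adj⇒dist≡1 hh′) ⟩
        α + 1                 ≡⟨ +-comm α 1 ⟩
        suc α                 ≡⟨ 1+α≡cb ⟩
        dist c b              ∎
        where open ≤-Reasoning
      2+r≤bd : 2 + r ≤ dist b d
      2+r≤bd = ≤-trans (s≤s r<ad) (≤-reflexive (≡.sym bd))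
      hb : Adj G h b
      hb = adjacent-to-between c→b b→d (≤-reflexive (≡.trans (cong suc ch≡α) 1+α≡cb))
                                       (≤-trans (≤-reflexive (cong suc hd≡1+r)) 2+r≤bd)
      h′a : Adj G h′ a
      h′a = adjacent-to-between c→a a→d (≤-trans (s≤s ch′≤cb) (≤-reflexive (≡.sym ca)))
                                        (≤-trans (≤-reflexive (cong suc h′d≡r)) r<ad)
      2≤bh′ : 2 ≤ dist b h′
      2≤bh′ = apart-left 2+r≤bd (≤-reflexive h′d≡r)
      2≤ha : 2 ≤ dist h a
      2≤ha = apart-right (≤-reflexive (≡.trans (cong suc 1+α≡cb) (≡.sym ca))) (≤-reflexive ch≡α)

  no-quadrangle₃ : TransitiveOrientationOfComplement G → ¬ Quadrangle 3
  no-quadrangle₃ T q = no-chain-quadrangle₃ (quadrangle-chain q apart)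
    where
    open Orientation T
    apart : SidesApart q
    apart = sides-apart (side-apart₃ q) (side-apart₃ (rotate q))
                        (side-apart₃ (rotate (rotate q))) (side-apart₃ (rotate (rotate (rotate q))))

  -- Isometric 4-cycles

  ladder : TransitiveOrientationOfComplement G → ∀ n {y t z s} → Adj G y t → Adj G z s →
    dist t z ≡ 1 + n → dist y s ≡ 1 + n → dist y z ≡ 2 + n → dist t s ≡ 2 + n → IsometricC4 G
  ladder T zero yt zs tz ys yz ts =
    isometric-C4 yt (dist≡1⇒adj tz) zs (Graph.sym G (dist≡1⇒adj ys)) (≡2+⇒2≤ yz) (≡2+⇒2≤ ts)
  ladder T (suc n) {y} {t} {z} {s} yt zs tz ys yz ts
    with last-step (≡1+⇒1≤ tz) | last-step (≡1+⇒1≤ ys)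
  ... | z′ , z′z , 1+tz′≡tz | s′ , s′s , 1+ys′≡ys = ladder T n yt rung tz′ ys′ yz′ ts′
    where
    tz′ : dist t z′ ≡ 1 + n
    tz′ = suc-injective (≡.trans 1+tz′≡tz tz)
    ys′ : dist y s′ ≡ 1 + n
    ys′ = suc-injective (≡.trans 1+ys′≡ys ys)
    yz′ : dist y z′ ≡ 2 + n
    yz′ = dist-via-neighbours yt z′z tz′ yz
    ts′ : dist t s′ ≡ 2 + n
    ts′ = dist-via-neighbours (Graph.sym G yt) s′s ys′ ts
    rung : Adj G z′ s′
    rung with Orientation.orient-apart T (≡2+⇒2≤ ts)
    ... | inj₁ t→s = Orientation.ladder-rung T t→s yt zs z′z s′s tz yz ts tz′ yz′ ys′
    ... | inj₂ s→t = Orientation.ladder-rung (converse T) s→t yt zs z′z s′s tz yz ts tz′ yz′ ys′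

  tripod-arc : (T : TransitiveOrientationOfComplement G) → ∀ {n a b c d} → Adj G a b → Adj G b c →
    TransitiveOrientationOfComplement.Arc T a c →
    dist a c ≡ 2 → dist a d ≡ 2 + n → dist c d ≡ 2 + n → dist b d ≡ 3 + n → IsometricC4 G
  tripod-arc T ab bc a→c ac ad cd bd
    with Orientation.orient-apart T (≡2+⇒2≤ cd) | Orientation.orient-apart T (≡2+⇒2≤ ad)
  ... | inj₁ c→d | _        = Orientation.tripod-core T ab bc a→c c→d ac ad cd bd
  ... | inj₂ d→c | inj₂ d→a =
    Orientation.tripod-core (converse T) (Graph.sym G bc) (Graph.sym G ab) a→c d→a
      (≡.trans (dist-sym _ _) ac) cd ad bd
  ... | inj₂ d→c | inj₁ a→d =
    ⊥-elim (Orientation.¬apart-from-common-neighbour T a→d d→c ab bc (≡2+⇒2≤ bd))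

  tripod : TransitiveOrientationOfComplement G → ∀ n {a b c d} → Adj G a b → Adj G b c →
    dist a c ≡ 2 → dist a d ≡ n → dist c d ≡ n → dist b d ≡ suc n → IsometricC4 G
  tripod T zero ab bc ac ad cd bd with dist≡0⇒≡ ad | dist≡0⇒≡ cd
  ... | refl | refl with ≡.trans (≡.sym dist-refl) ac
  ...   | ()
  tripod T 1 ab bc ac ad cd bd =
    isometric-C4 ab bc (dist≡1⇒adj cd) (Graph.sym G (dist≡1⇒adj ad)) (≡2+⇒2≤ ac) (≡2+⇒2≤ bd)
  tripod T (suc (suc n)) ab bc ac ad cd bd with Orientation.orient-apart T (≡2+⇒2≤ ac)
  ... | inj₁ a→c = tripod-arc T ab bc a→c ac ad cd bd
  ... | inj₂ c→a =
    tripod-arc T (Graph.sym G bc) (Graph.sym G ab) c→a (≡.trans (dist-sym _ _) ac) cd ad bd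

  one-close-side : TransitiveOrientationOfComplement G → (q : Quadrangle 2) →
    let open Quadrangle q in dist a b ≤ 1 → 2 ≤ dist b c → 2 ≤ dist d a → IsometricC4 G
  one-close-side T q ab≤1 2≤bc 2≤da = by-cases (orient-apart 2≤ac) (orient-apart 2≤ad)
    where
    open Quadrangle q
    open UnitSide (unit-side q ab≤1)
    open Orientation T
    2≤ad : 2 ≤ dist a d
    2≤ad = apart-sym 2≤da
    2≤ac : 2 ≤ dist a c
    2≤ac = ≤-trans (≤-trans 2≤bc (n≤1+n _)) (≤-reflexive (≡.sym ac≡1+bc))
    2≤bd : 2 ≤ dist b d
    2≤bd = ≤-trans (≤-trans 2≤ad (n≤1+n _)) (≤-reflexive (≡.sym bd≡1+ad))
    ca≡1+cb : dist c a ≡ suc (dist c b)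
    ca≡1+cb = ≡.trans (dist-sym c a) (≡.trans ac≡1+bc (cong suc (dist-sym b c)))
    cd<ad+cb : dist c d < dist a d + dist c b
    cd<ad+cb = subst (λ bc → dist c d < dist a d + bc) (dist-sym b c) cd<ad+bc
    by-cases : Arc a c ⊎ Arc c a → Arc a d ⊎ Arc d a → IsometricC4 G
    by-cases (inj₁ a→c) (inj₁ a→d) =
      one-same adjacent a→c (arc-from-neighbour adjacent 2≤bd a→d) 2≤ad 2≤bc bd≡1+ad ac≡1+bc
    by-cases (inj₁ a→c) (inj₂ d→a) =
      Orientation.one-cross (converse T) adjacent a→c d→a (arc-from-neighbour adjacent 2≤bc a→c)
        (arc-to-neighbour adjacent (apart-sym 2≤bd) d→a) ca≡1+cb bd≡1+ad cd<ad+cb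
    by-cases (inj₂ c→a) (inj₁ a→d) =
      one-cross adjacent c→a a→d (arc-to-neighbour adjacent (apart-sym 2≤bc) c→a)
        (arc-from-neighbour adjacent 2≤bd a→d) ca≡1+cb bd≡1+ad cd<ad+cb
    by-cases (inj₂ c→a) (inj₂ d→a) =
      Orientation.one-same (converse T) adjacent c→a (arc-to-neighbour adjacent (apart-sym 2≤bd) d→a)
        2≤ad 2≤bc bd≡1+ad ac≡1+bc

  crossing-C4 : (T : TransitiveOrientationOfComplement G) → let open Orientation T in
    ∀ {p₁ p₂ p₃ p₄} → Arc p₁ p₂ → Arc p₂ p₃ → Arc p₃ p₄ →
    dist p₁ p₄ + dist p₂ p₃ + 2 ≤ dist p₁ p₃ + dist p₂ p₄ → IsometricC4 G
  crossing-C4 T {p₁} {p₂} {p₃} {p₄} a₁₂ a₂₃ a₃₄ h =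
    build (tight-detour a₁₂ (arc-trans a₂₃ a₃₄) tight₁₂₄) (first-step (<⇒≤ (arc⇒apart a₂₃)))
    where
    open Orientation T
    open ≤-Reasoning
    d₁₂ = dist p₁ p₂ ; d₁₃ = dist p₁ p₃ ; d₁₄ = dist p₁ p₄
    d₂₃ = dist p₂ p₃ ; d₂₄ = dist p₂ p₄ ; d₃₄ = dist p₃ p₄

    tight₁₂₄ : d₁₄ + 2 ≤ d₁₂ + d₂₄
    tight₁₂₄ = +-cancelʳ-≤ d₂₃ (d₁₄ + 2) (d₁₂ + d₂₄) (begin
      d₁₄ + 2 + d₂₃    ≡⟨ xy∙z≈xz∙y d₁₄ 2 d₂₃ ⟩
      d₁₄ + d₂₃ + 2    ≤⟨ h ⟩
      d₁₃ + d₂₄        ≤⟨ +-monoˡ-≤ d₂₄ (dist-triangle p₁ p₂ p₃) ⟩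
      d₁₂ + d₂₃ + d₂₄  ≡⟨ xy∙z≈xz∙y d₁₂ d₂₃ d₂₄ ⟩
      d₁₂ + d₂₄ + d₂₃  ∎)

    p₃-on-geodesic : d₂₃ + d₃₄ ≤ d₂₄
    p₃-on-geodesic = +-cancelˡ-≤ (d₁₄ + 2) (d₂₃ + d₃₄) d₂₄ (begin
      d₁₄ + 2 + (d₂₃ + d₃₄)  ≡⟨ shuffle d₁₄ d₂₃ d₃₄ ⟩
      d₁₄ + d₂₃ + 2 + d₃₄    ≤⟨ +-monoˡ-≤ d₃₄ h ⟩
      d₁₃ + d₂₄ + d₃₄        ≡⟨ xy∙z≈xz∙y d₁₃ d₂₄ d₃₄ ⟩
      d₁₃ + d₃₄ + d₂₄        ≤⟨ +-monoˡ-≤ d₂₄ (between-sum (arc-trans a₁₂ a₂₃) a₃₄) ⟩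
      d₁₄ + 2 + d₂₄          ∎)
      where
      shuffle : ∀ x y z → x + 2 + (y + z) ≡ x + y + 2 + z
      shuffle = solve-∀

    p₂-on-geodesic : d₁₂ + d₂₃ ≤ d₁₃
    p₂-on-geodesic = +-cancelʳ-≤ d₂₄ (d₁₂ + d₂₃) d₁₃ (begin
      d₁₂ + d₂₃ + d₂₄  ≡⟨ xy∙z≈xz∙y d₁₂ d₂₃ d₂₄ ⟩
      d₁₂ + d₂₄ + d₂₃  ≤⟨ +-monoˡ-≤ d₂₃ (between-sum a₁₂ (arc-trans a₂₃ a₃₄)) ⟩
      d₁₄ + 2 + d₂₃    ≡⟨ xy∙z≈xz∙y d₁₄ 2 d₂₃ ⟩
      d₁₄ + d₂₃ + 2    ≤⟨ h ⟩
      d₁₃ + d₂₄        ∎)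

    build : (Σ (V G) λ y → Adj G y p₂ × suc (dist p₁ y) ≡ d₁₂ × suc (dist y p₄) ≡ d₂₄) →
            (Σ (V G) λ s → Adj G p₂ s × suc (dist s p₃) ≡ d₂₃) → IsometricC4 G
    build (y , yp₂ , 1+p₁y≡d₁₂ , 1+yp₄≡d₂₄) (s , p₂s , 1+sp₃≡d₂₃) =
      tripod T (dist y p₄) yp₂ p₂s (dist≡2 yp₂ p₂s 2≤ys) refl sp₄≡yp₄ (≡.sym 1+yp₄≡d₂₄)
      where
      sp₄≡yp₄ : dist s p₄ ≡ dist y p₄
      sp₄≡yp₄ = ≤-antisym (≤-pred (begin
          suc (dist s p₄)               ≤⟨ s≤s (dist-triangle s p₃ p₄) ⟩
          suc (dist s p₃) + d₃₄         ≡⟨ cong (_+ d₃₄) 1+sp₃≡d₂₃ ⟩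
          d₂₃ + d₃₄                     ≤⟨ p₃-on-geodesic ⟩
          d₂₄                           ≡⟨ 1+yp₄≡d₂₄ ⟨
          suc (dist y p₄)               ∎))
        (≤-pred (≤-trans (≤-reflexive 1+yp₄≡d₂₄) (adj⇒dist≤1+ p₄ p₂s)))
      2≤ys : 2 ≤ dist y s
      2≤ys = +-cancelʳ-≤ (dist p₁ y + dist s p₃) 2 (dist y s) (begin
        2 + (dist p₁ y + dist s p₃)             ≡⟨ shuffle (dist p₁ y) (dist s p₃) ⟩
        suc (dist p₁ y) + suc (dist s p₃)       ≡⟨ ≡.cong₂ _+_ 1+p₁y≡d₁₂ 1+sp₃≡d₂₃ ⟩
        d₁₂ + d₂₃                               ≤⟨ p₂-on-geodesic ⟩
        d₁₃                                     ≤⟨ dist-triangle p₁ y p₃ ⟩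
        dist p₁ y + dist y p₃                   ≤⟨ +-monoʳ-≤ (dist p₁ y) (dist-triangle y s p₃) ⟩
        dist p₁ y + (dist y s + dist s p₃)      ≡⟨ x∙yz≈y∙xz (dist p₁ y) (dist y s) (dist s p₃) ⟩
        dist y s + (dist p₁ y + dist s p₃)      ∎)
        where
        shuffle : ∀ u v → 2 + (u + v) ≡ suc u + suc v
        shuffle = solve-∀

  nested-C4 : (T : TransitiveOrientationOfComplement G) → let open Orientation T in
    ∀ {p₁ p₂ p₃ p₄} → Arc p₁ p₂ → Arc p₂ p₃ → Arc p₃ p₄ →
    dist p₁ p₃ + dist p₂ p₄ + 2 ≤ dist p₁ p₄ + dist p₂ p₃ → IsometricC4 G
  nested-C4 T {p₁} {p₂} {p₃} {p₄} a₁₂ a₂₃ a₃₄ h =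
    build (tight-detour a₁₂ a₂₃ tight₁₂₃) (tight-detour a₂₃ a₃₄ tight₂₃₄) (m≤n⇒∃[o]m+o≡n (arc⇒apart a₂₃))
    where
    open Orientation T
    open ≤-Reasoning
    d₁₂ = dist p₁ p₂ ; d₁₃ = dist p₁ p₃ ; d₁₄ = dist p₁ p₄
    d₂₃ = dist p₂ p₃ ; d₂₄ = dist p₂ p₄ ; d₃₄ = dist p₃ p₄

    tight₁₂₃ : d₁₃ + 2 ≤ d₁₂ + d₂₃
    tight₁₂₃ = +-cancelʳ-≤ d₂₄ (d₁₃ + 2) (d₁₂ + d₂₃) (begin
      d₁₃ + 2 + d₂₄    ≡⟨ xy∙z≈xz∙y d₁₃ 2 d₂₄ ⟩
      d₁₃ + d₂₄ + 2    ≤⟨ h ⟩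
      d₁₄ + d₂₃        ≤⟨ +-monoˡ-≤ d₂₃ (dist-triangle p₁ p₂ p₄) ⟩
      d₁₂ + d₂₄ + d₂₃  ≡⟨ xy∙z≈xz∙y d₁₂ d₂₄ d₂₃ ⟩
      d₁₂ + d₂₃ + d₂₄  ∎)

    tight₂₃₄ : d₂₄ + 2 ≤ d₂₃ + d₃₄
    tight₂₃₄ = +-cancelˡ-≤ d₁₃ (d₂₄ + 2) (d₂₃ + d₃₄) (begin
      d₁₃ + (d₂₄ + 2)    ≡⟨ +-assoc d₁₃ d₂₄ 2 ⟨
      d₁₃ + d₂₄ + 2      ≤⟨ h ⟩
      d₁₄ + d₂₃          ≤⟨ +-monoˡ-≤ d₂₃ (dist-triangle p₁ p₃ p₄) ⟩
      d₁₃ + d₃₄ + d₂₃    ≡⟨ xy∙z≈x∙zy d₁₃ d₃₄ d₂₃ ⟩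
      d₁₃ + (d₂₃ + d₃₄)  ∎)

    outer : d₁₂ + d₂₄ ≤ d₁₄
    outer = +-cancelʳ-≤ d₂₃ (d₁₂ + d₂₄) d₁₄ (begin
      d₁₂ + d₂₄ + d₂₃  ≡⟨ xy∙z≈xz∙y d₁₂ d₂₄ d₂₃ ⟩
      d₁₂ + d₂₃ + d₂₄  ≤⟨ +-monoˡ-≤ d₂₄ (between-sum a₁₂ a₂₃) ⟩
      d₁₃ + 2 + d₂₄    ≡⟨ xy∙z≈xz∙y d₁₃ 2 d₂₄ ⟩
      d₁₃ + d₂₄ + 2    ≤⟨ h ⟩
      d₁₄ + d₂₃        ∎)

    build : (Σ (V G) λ y → Adj G y p₂ × suc (dist p₁ y) ≡ d₁₂ × suc (dist y p₃) ≡ d₂₃) →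
            (Σ (V G) λ z → Adj G z p₃ × suc (dist p₂ z) ≡ d₂₃ × suc (dist z p₄) ≡ d₃₄) →
            (∃ λ n → 2 + n ≡ d₂₃) → IsometricC4 G
    build (y , yp₂ , 1+p₁y≡d₁₂ , 1+yp₃≡d₂₃) (z , zp₃ , 1+p₂z≡d₂₃ , 1+zp₄≡d₃₄) (n , 2+n≡d₂₃) =
      ladder T n yp₂ zp₃ (suc-injective 1+p₂z≡2+n) (suc-injective (≡.trans 1+yp₃≡d₂₃ (≡.sym 2+n≡d₂₃)))
        yz≡2+n (≡.sym 2+n≡d₂₃)
      where
      u = dist p₁ y ; w = dist z p₄ ; e = dist y z
      shuffle₁ : ∀ x u w → x + (u + w + 2) ≡ x + suc w + suc u
      shuffle₁ = solve-∀
      shuffle₂ : ∀ x y → x + 2 + y ≡ y + x + 2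
      shuffle₂ = solve-∀
      shuffle₃ : ∀ u e w → u + (e + w) + 2 ≡ e + (u + w + 2)
      shuffle₃ = solve-∀
      1+p₂z≡2+n : suc (dist p₂ z) ≡ 2 + n
      1+p₂z≡2+n = ≡.trans 1+p₂z≡d₂₃ (≡.sym 2+n≡d₂₃)
      d₁₄≤ : d₁₄ ≤ u + (e + w)
      d₁₄≤ = ≤-trans (dist-triangle p₁ y p₄) (+-monoʳ-≤ u (dist-triangle y z p₄))
      d₂₃≤e : d₂₃ ≤ e
      d₂₃≤e = +-cancelʳ-≤ (u + w + 2) d₂₃ e (begin
        d₂₃ + (u + w + 2)    ≡⟨ shuffle₁ d₂₃ u w ⟩
        d₂₃ + suc w + suc u  ≡⟨ ≡.cong₂ (λ p q → d₂₃ + p + q) 1+zp₄≡d₃₄ 1+p₁y≡d₁₂ ⟩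
        d₂₃ + d₃₄ + d₁₂      ≤⟨ +-monoˡ-≤ d₁₂ (between-sum a₂₃ a₃₄) ⟩
        d₂₄ + 2 + d₁₂        ≡⟨ shuffle₂ d₂₄ d₁₂ ⟩
        d₁₂ + d₂₄ + 2        ≤⟨ +-monoˡ-≤ 2 outer ⟩
        d₁₄ + 2              ≤⟨ +-monoˡ-≤ 2 d₁₄≤ ⟩
        u + (e + w) + 2      ≡⟨ shuffle₃ u e w ⟩
        e + (u + w + 2)      ∎)
      yz≡2+n : e ≡ 2 + n
      yz≡2+n = ≤-antisym (≤-trans (adj⇒dist≤1+ z yp₂) (≤-reflexive 1+p₂z≡2+n))
                         (≤-trans (≤-reflexive 2+n≡d₂₃) d₂₃≤e)

  chain-C4 : (T : TransitiveOrientationOfComplement G) → Orientation.ChainQuadrangle T 2 → IsometricC4 G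
  chain-C4 T (Orientation.consecutive a₁₂ a₂₃ a₃₄ h) =
    ⊥-elim (Orientation.no-consecutive-chain T a₁₂ a₂₃ a₃₄ h)
  chain-C4 T (Orientation.crossing a₁₂ a₂₃ a₃₄ h)    = crossing-C4 T a₁₂ a₂₃ a₃₄ h
  chain-C4 T (Orientation.nested a₁₂ a₂₃ a₃₄ h)      = nested-C4 T a₁₂ a₂₃ a₃₄ h

  adjacent-close-sides : TransitiveOrientationOfComplement G → (q : Quadrangle 2) →
    let open Quadrangle q in dist a b ≤ 1 → dist b c ≤ 1 → IsometricC4 G
  adjacent-close-sides T q ab≤1 bc≤1 =
    tripod T (dist a d) (UnitSide.adjacent u₁) (UnitSide.adjacent u₂) ac≡2 refl cd≡ad
      (UnitSide.bd≡1+ad u₁)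
    where
    open Quadrangle q
    u₁ = unit-side q ab≤1
    u₂ = unit-side (rotate q) bc≤1
    ac≡2 : dist a c ≡ 2
    ac≡2 = ≡.trans (UnitSide.ac≡1+bc u₁) (cong suc (adj⇒dist≡1 (UnitSide.adjacent u₂)))
    cd≡ad : dist c d ≡ dist a d
    cd≡ad = suc-injective (≡.trans (≡.sym (UnitSide.ac≡1+bc u₂)) (UnitSide.bd≡1+ad u₁))

  opposite-close-sides : TransitiveOrientationOfComplement G → (q : Quadrangle 2) →
    let open Quadrangle q in dist a b ≤ 1 → dist c d ≤ 1 → IsometricC4 G
  opposite-close-sides T q ab≤1 cd≤1 = with-predecessor (m≤n⇒∃[o]m+o≡n 1≤bc)
    where
    open Quadrangle q
    u₁ = unit-side q ab≤1
    u₂ = unit-side (rotate (rotate q)) cd≤1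
    1≤bc : 1 ≤ dist b c
    1≤bc = ≤-pred (≤-trans (diagonal-apart q) (≤-reflexive (UnitSide.ac≡1+bc u₁)))
    bc≡ad : dist b c ≡ dist a d
    bc≡ad = suc-injective (begin
      suc (dist b c)  ≡⟨ UnitSide.ac≡1+bc u₁ ⟨
      dist a c        ≡⟨ dist-sym a c ⟩
      dist c a        ≡⟨ UnitSide.ac≡1+bc u₂ ⟩
      suc (dist d a)  ≡⟨ cong suc (dist-sym d a) ⟩
      suc (dist a d)  ∎)
      where open ≡.≡-Reasoning
    with-predecessor : (∃ λ n → 1 + n ≡ dist b c) → IsometricC4 G
    with-predecessor (n , 1+n≡bc) =
      ladder T n (UnitSide.adjacent u₁) (UnitSide.adjacent u₂) (≡.sym 1+n≡bc) ad≡1+n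
        (≡.trans (UnitSide.ac≡1+bc u₁) (cong suc (≡.sym 1+n≡bc)))
        (≡.trans (UnitSide.bd≡1+ad u₁) (cong suc ad≡1+n))
      where
      ad≡1+n : dist a d ≡ 1 + n
      ad≡1+n = ≡.trans (≡.sym bc≡ad) (≡.sym 1+n≡bc)

  quadrangle-C4 : TransitiveOrientationOfComplement G → Quadrangle 2 → IsometricC4 G
  quadrangle-C4 T q = by-sides (2 ≤? dist a b) (2 ≤? dist b c) (2 ≤? dist c d) (2 ≤? dist d a)
    where
    open Quadrangle q
    q¹ = rotate q
    q² = rotate q¹
    q³ = rotate q²
    by-sides : Dec (2 ≤ dist a b) → Dec (2 ≤ dist b c) → Dec (2 ≤ dist c d) → Dec (2 ≤ dist d a) →
      IsometricC4 G
    by-sides (yes ab) (yes bc) (yes cd) (yes da) =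
      chain-C4 T (Orientation.quadrangle-chain T q (sides-apart ab bc cd da))
    by-sides (no ab)  (yes bc) (yes cd) (yes da) = one-close-side T q (≰2⇒≤1 ab) bc da
    by-sides (yes ab) (no bc)  (yes cd) (yes da) = one-close-side T q¹ (≰2⇒≤1 bc) cd ab
    by-sides (yes ab) (yes bc) (no cd)  (yes da) = one-close-side T q² (≰2⇒≤1 cd) da bc
    by-sides (yes ab) (yes bc) (yes cd) (no da)  = one-close-side T q³ (≰2⇒≤1 da) ab cd
    by-sides (no ab)  (no bc)  _        _        = adjacent-close-sides T q (≰2⇒≤1 ab) (≰2⇒≤1 bc)
    by-sides _        (no bc)  (no cd)  _        = adjacent-close-sides T q¹ (≰2⇒≤1 bc) (≰2⇒≤1 cd)
    by-sides _        _        (no cd)  (no da)  = adjacent-close-sides T q² (≰2⇒≤1 cd) (≰2⇒≤1 da)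
    by-sides (no ab)  _        _        (no da)  = adjacent-close-sides T q³ (≰2⇒≤1 da) (≰2⇒≤1 ab)
    by-sides (no ab)  _        (no cd)  _        = opposite-close-sides T q (≰2⇒≤1 ab) (≰2⇒≤1 cd)
    by-sides _        (no bc)  _        (no da)  = opposite-close-sides T q¹ (≰2⇒≤1 bc) (≰2⇒≤1 da)

isometric-C4-lower-bound : ∀ {G} → IsometricC4 G → ∀ k → HalfHyperbolic G k → 2 ≤ k
isometric-C4-lower-bound C4 k hyperbolic =
  hyperbolic v₀ v₂ v₁ v₃ 2 2 1 1 1 1 (isometric zero two) (isometric one three) (isometric one zero)
                                     (isometric three two) (isometric one two) (isometric three zero)
  where
  open IsometricC4 C4
  one two three : Fin 4
  one = suc zero ; two = suc (suc zero) ; three = suc (suc (suc zero))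
  v₀ = f zero ; v₁ = f one ; v₂ = f two ; v₃ = f three

corollary2p20 : ExcludedMiddle 0ℓ → (G : Graph) → Connected G → Cocomparability G →
    HalfHyperbolic G 2 × (HyperbolicityIs G 2 ⇔ IsometricC4 G)
corollary2p20 em G connected T = one-hyperbolic , mk⇔ isometric-C4-of-δ*≡1 δ*≡1-of-isometric-C4
  where
  open Metric em G connected
  one-hyperbolic : HalfHyperbolic G 2
  one-hyperbolic = hyperbolic-unless 2 (no-quadrangle₃ T)
  isometric-C4-of-δ*≡1 : HyperbolicityIs G 2 → IsometricC4 G
  isometric-C4-of-δ*≡1 (_ , minimal) = decidable-stable em λ no-C4 →
    2≰1 (minimal 1 (hyperbolic-unless 1 λ q → no-C4 (quadrangle-C4 T q)))
    where
    2≰1 : ¬ 2 ≤ 1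
    2≰1 (s≤s ())
  δ*≡1-of-isometric-C4 : IsometricC4 G → HyperbolicityIs G 2
  δ*≡1-of-isometric-C4 C4 = one-hyperbolic , isometric-C4-lower-bound C4
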